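{- Let $\mathcal{S}$ and $\mathcal{T}$ be $\ltimes$-transition systems, let $\mathcal{A}$ be an HDA satisfying conditions HM1 and HM2 with respect to $\mathcal{S}$, and let $\mathcal{B}$ be an HDA model of $\mathcal{T}$. Then for every morphism of $\ltimes$-transition systems $(f,\sigma):\mathcal{S}\to\mathcal{T}$ there exists a unique morphism of HDAs $\mathcal{A}\to\mathcal{B}$ whose restriction to degrees $\le1$ is $(f,\sigma):U(\mathcal{S})\to U(\mathcal{T})$ (i.e. its precubical component agrees with $f$ on cubes of degree $\le1$ and its label map is $\sigma$).
   Context: A precubical set $P$ is a family of sets $(P_n)_{n\ge0}$ with face maps $d^k_i:P_n\to P_{n-1}$ ($n>0$, $k\in\{0,1\}$, $1\le i\le n$) satisfying $d^k_id^l_j=d^l_{j-1}d^k_i$ for $i<j$; morphisms commute with faces; a precubical subset is closed under faces. An HDA is $\mathcal{A}=(P_\mathcal{A},I_\mathcal{A},F_\mathcal{A},\Sigma_\mathcal{A},\lambda_\mathcal{A})$ with $P_\mathcal{A}$ a precubical set, $I_\mathcal{A}$ a vertex, $F_\mathcal{A}$ a set of vertices, $\lambda_\mathcal{A}:(P_\mathcal{A})_1\to\Sigma_\mathcal{A}$ with $\lambda_\mathcal{A}(d^0_ix)=\lambda_\mathcal{A}(d^1_ix)$ for 2-cubes $x$, $i=1,2$. A morphism $(g,\sigma):\mathcal{A}\to\mathcal{B}$ consists of a precubical morphism $g$ and a map $\sigma:\Sigma_\mathcal{A}\to\Sigma_\mathcal{B}$ with $g(I_\mathcal{A})=I_\mathcal{B}$,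 $g(F_\mathcal{A})\subseteq F_\mathcal{B}$, $\lambda_\mathcal{B}(g(x))=\sigma(\lambda_\mathcal{A}(x))$ for all edges $x$. $\mathcal{B}$ is a subautomaton of $\mathcal{A}$ if $P_\mathcal{B}$ is a precubical subset of $P_\mathcal{A}$, $\Sigma_\mathcal{B}\subseteq\Sigma_\mathcal{A}$, $I_\mathcal{B}=I_\mathcal{A}$, $F_\mathcal{B}\subseteq F_\mathcal{A}$, $\lambda_\mathcal{B}=\lambda_\mathcal{A}$ on $(P_\mathcal{B})_1$. $\mathcal{A}_{\le1}$ keeps only cubes of degree $\le1$. A transition system is an HDA without cubes of degree $\ge2$ in which two edges with equal label, equal $d^0_1$ and equal $d^1_1$ coincide. A $\ltimes$-transition system $\mathcal{T}$ is a transition system $U(\mathcal{T})$ with an arbitrary binary relation $\ltimes_\mathcal{T}$ on its label set; a morphism of $\ltimes$-transition systems is an HDA morphism $(f,\sigma)$ of underlying transition systems such that $\alpha\ltimes_\mathcal{S}\beta$ implies $\sigma(\alpha)\ltimes_\mathcal{T}\sigma(\beta)$. Conditions with respect to $\mathcal{T}$: (HM1) $\mathcal{A}_{\le1}=U(\mathcal{T})$; (HM2) for all $x\in(P_\mathcal{A})_2$, $\lambda_\mathcal{A}(d^0_2x)\ltimes_\mathcal{T}\lambda_\mathcal{A}(d^0_1x)$; (HM3) for all $m\ge2$ and $x,y\in(P_\mathcal{A})_m$, if $d^k_rx=d^k_ry$ for all $r,k$ then $x=y$; (HM4) $\mathcal{A}$ is not a proper subautomaton of any HDA satisfying HM1–HM3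 with respect to $\mathcal{T}$. An HDA model of $\mathcal{T}$ is an HDA satisfying HM1–HM4. -}

module Defs where

open import Data.Nat using (ℕ; zero; suc; _≤_)
open import Data.Fin using (Fin; zero; suc; toℕ; inject₁)
open import Data.Bool using (Bool; true; false)
open import Data.Product using (Σ; _×_; _,_; ∃)
open import Relation.Nullary using (¬_)
open import Relation.Binary.PropositionalEquality using (_≡_; refl)
open import Function.Definitions using (Injective)

-- Conventions: face maps are 0-indexed (Fin), i.e. paper's d^k_i is
-- `d (i-1) k`; the bit k ∈ {0,1} is a Bool with false = 0, true = 1.

coe : {A B : Set} → A ≡ B → A → B
coe refl x = x

Surj : {A B : Set} → (A → B) → Set
Surj {A} {B} f = ∀ (y : B) → ∃ λ (x : A) → f x ≡ y

-- Precubical sets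
-- cubical: d^k_i d^l_j = d^l_{j-1} d^k_i for i < j  (1-indexed);
-- 0-indexed with j = suc j' this reads: i ≤ j' ⇒
--   d i k (d (suc j') l x) ≡ d j' l (d (inject₁ i) k x)

record PreCubicalSet : Set₁ where
  field
    Cube : ℕ → Set
    d : ∀ {n} → Fin (suc n) → Bool → Cube (suc n) → Cube n
    cubical : ∀ {n} (i j : Fin (suc n)) (k l : Bool) (x : Cube (suc (suc n))) →
              toℕ i ≤ toℕ j →
              d i k (d (suc j) l x) ≡ d j l (d (inject₁ i) k x)

record HDA : Set₁ where
  field
    P : PreCubicalSet
  open PreCubicalSet P public
  field
    I : Cube 0
    F : Cube 0 → Set
    Lab : Set
    lab : Cube 1 → Lab
    lab-face : ∀ (x : Cube 2) (i : Fin 2) → lab (d i false x) ≡ lab (d i true x)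

open HDA

record HDAHom (A B : HDA) : Set where
  field
    g : ∀ n → Cube A n → Cube B n
    g-d : ∀ {n} (i : Fin (suc n)) (k : Bool) (x : Cube A (suc n)) →
          g n (d A i k x) ≡ d B i k (g (suc n) x)
    σ : Lab A → Lab B
    g-I : g 0 (I A) ≡ I B
    g-F : ∀ v → F A v → F B (g 0 v)
    g-lab : ∀ x → lab B (g 1 x) ≡ σ (lab A x)

open HDAHom

HomEq : {A B : HDA} → HDAHom A B → HDAHom A B → Set
HomEq h h' = (∀ n x → g h n x ≡ g h' n x) × (∀ a → σ h a ≡ σ h' a)

IsTransitionSystem : HDA → Set
IsTransitionSystem A =
  (∀ n → ¬ Cube A (suc (suc n))) ×
  (∀ (x y : Cube A 1) → lab A x ≡ lab A y →
     d A zero false x ≡ d A zero false y →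
     d A zero true x ≡ d A zero true y → x ≡ y)

record ⋉TS : Set₁ where
  field
    U : HDA
    isTS : IsTransitionSystem U
    ⋉ : Lab U → Lab U → Set

open ⋉TS

record ⋉Hom (S T : ⋉TS) : Set where
  field
    hom : HDAHom (U S) (U T)
    pres : ∀ α β → ⋉ S α β → ⋉ T (σ hom α) (σ hom β)

open ⋉Hom

-- Subautomata: B is (identified with) a subautomaton of C via an
-- injective HDA morphism with injective label map; it is proper iff it
-- is not all of C (not onto in some degree, or on labels, or on finals).

record SubEmbedding (B C : HDA) : Set where
  field
    emb : HDAHom B C
    g-inj : ∀ n → Injective _≡_ _≡_ (g emb n)
    σ-inj : Injective _≡_ _≡_ (σ emb)

open SubEmbedding

IsProper : {B C : HDA} → SubEmbedding B C → Set
IsProper {B} {C} e =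
  ¬ ((∀ n → Surj (g (emb e) n)) × Surj (σ (emb e)) ×
     (∀ v → F C (g (emb e) 0 v) → F B v))

-- HM1 : A_{≤1} = U(T)  (literal equality of the degree ≤ 1 data)
record HM1 (A : HDA) (T : ⋉TS) : Set₁ where
  field
    e0 : Cube A 0 ≡ Cube (U T) 0
    e1 : Cube A 1 ≡ Cube (U T) 1
    eL : Lab A ≡ Lab (U T)
    d-eq : ∀ (i : Fin 1) (k : Bool) (x : Cube A 1) →
           coe e0 (d A i k x) ≡ d (U T) i k (coe e1 x)
    I-eq : coe e0 (I A) ≡ I (U T)
    F-eq : ∀ v → (F A v → F (U T) (coe e0 v)) × (F (U T) (coe e0 v) → F A v)
    lab-eq : ∀ x → coe eL (lab A x) ≡ lab (U T) (coe e1 x)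

open HM1

HM2 : (A : HDA) (T : ⋉TS) → HM1 A T → Set
HM2 A T h = ∀ (x : Cube A 2) →
  ⋉ T (coe (eL h) (lab A (d A (suc zero) false x)))
      (coe (eL h) (lab A (d A zero false x)))

HM3 : HDA → Set
HM3 A = ∀ n (x y : Cube A (suc (suc n))) →
  (∀ (r : Fin (suc (suc n))) (k : Bool) → d A r k x ≡ d A r k y) → x ≡ y

-- a subautomaton embedding between two HDAs satisfying HM1 w.r.t. T is
-- literally an inclusion, hence the identity in degrees ≤ 1 and on labels
IdOnSkeleton : {B C : HDA} {T : ⋉TS} → HM1 B T → HM1 C T → SubEmbedding B C → Set
IdOnSkeleton hB hC e =
  (∀ x → coe (e0 hC) (g (emb e) 0 x) ≡ coe (e0 hB) x) ×
  (∀ x → coe (e1 hC) (g (emb e) 1 x) ≡ coe (e1 hB) x) ×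
  (∀ a → coe (eL hC) (σ (emb e) a) ≡ coe (eL hB) a)

HM4 : (A : HDA) (T : ⋉TS) → HM1 A T → Set₁
HM4 A T hA = ∀ (C : HDA) (hC : HM1 C T) → HM2 C T hC → HM3 C →
  (e : SubEmbedding A C) → IdOnSkeleton hA hC e → ¬ IsProper e

record HDAModel (B : HDA) (T : ⋉TS) : Set₁ where
  field
    hm1 : HM1 B T
    hm2 : HM2 B T hm1
    hm3 : HM3 B
    hm4 : HM4 B T hm1

open HDAModel

RestrictsTo : {A B : HDA} {S T : ⋉TS} → HM1 A S → HM1 B T →
              HDAHom A B → ⋉Hom S T → Set
RestrictsTo hA hB h f =
  (∀ x → coe (e0 hB) (g h 0 x) ≡ g (hom f) 0 (coe (e0 hA) x)) ×
  (∀ x → coe (e1 hB) (g h 1 x) ≡ g (hom f) 1 (coe (e1 hA) x)) ×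
  (∀ a → coe (eL hB) (σ h a) ≡ σ (hom f) (coe (eL hA) a))

-- The morphism is forced in degrees ≤ 1 by (f, σ). It extends one degree at a
-- time: the faces of a cube x of A are already mapped to a compatible family of
-- cubes of B (a shell), and x must go to a cube of B with exactly those faces.
-- Such a cube exists (classically) because B is a model: otherwise adjoining a
-- new cube with that boundary would give an HDA satisfying HM1–HM3 (HM2 for a
-- new 2-cube is where the ⋉-preservation of σ and HM2 for A are used) of which
-- B is a proper subautomaton, contradicting HM4. By HM3 that cube is unique,
-- which gives uniqueness of the whole morphism.
module Submission where

open import Defs
open import Level using (0ℓ)
open import Axiom.ExcludedMiddle using (ExcludedMiddle)
open import Data.Nat using (ℕ; zero; suc; _≤_)
open import Data.Nat.Properties using (≡-irrelevant)
open import Data.Fin using (Fin; zero; suc; toℕ; inject₁)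
open import Data.Bool using (Bool; true; false)
open import Data.Product using (Σ; _×_; _,_; proj₁; proj₂; ∃)
open import Data.Sum using (_⊎_; inj₁; inj₂)
open import Data.Unit using (⊤; tt)
open import Data.Empty using (⊥-elim)
open import Relation.Nullary using (¬_; yes; no)
open import Relation.Binary.PropositionalEquality
  using (_≡_; refl; sym; trans; cong; subst; subst₂; module ≡-Reasoning)

open HDA
open HDAHom
open HM1
open ⋉TS
open ⋉Hom
open HDAModel

coe⁻ : {A B : Set} → A ≡ B → B → A
coe⁻ e = coe (sym e)

coe-coe⁻ : {A B : Set} (e : A ≡ B) (y : B) → coe e (coe⁻ e y) ≡ y
coe-coe⁻ refl y = refl

coe-transpose : {A B : Set} (e : A ≡ B) {x : A} {y : B} → coe e x ≡ y → x ≡ coe⁻ e y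
coe-transpose refl p = p

coe⁻-transpose : {A B : Set} (e : A ≡ B) {x : A} {y : B} → y ≡ coe e x → coe⁻ e y ≡ x
coe⁻-transpose refl p = p

Shell : HDA → ℕ → Set
Shell B m = Fin (suc (suc m)) → Bool → Cube B (suc m)

IsShell : (B : HDA) (m : ℕ) → Shell B m → Set
IsShell B m b = ∀ (i j : Fin (suc m)) (k l : Bool) → toℕ i ≤ toℕ j →
  d B i k (b (suc j) l) ≡ d B j l (b (inject₁ i) k)

Filler : (B : HDA) (m : ℕ) → Shell B m → Set
Filler B m b = ∃ λ (y : Cube B (suc (suc m))) → ∀ r k → d B r k y ≡ b r k

-- Only a 2-shell carries a constraint: its edges are labelled like the
-- boundary of a 2-cube of an HDA satisfying HM2.
AdmissibleShell : (B : HDA) (T : ⋉TS) → HM1 B T → (m : ℕ) → Shell B m → Set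
AdmissibleShell B T hB zero b =
  (∀ i → lab B (b i false) ≡ lab B (b i true)) ×
  ⋉ T (coe (eL hB) (lab B (b (suc zero) false))) (coe (eL hB) (lab B (b zero false)))
AdmissibleShell B T hB (suc m) b = ⊤

module AdjoinedCubes (B : HDA) (m : ℕ) (b : Shell B m) where

  -- the new cube is the unique element inj₂ refl of degree m + 2
  Cube⁺ : ℕ → Set
  Cube⁺ zero = Cube B 0
  Cube⁺ (suc zero) = Cube B 1
  Cube⁺ (suc (suc n)) = Cube B (suc (suc n)) ⊎ (n ≡ m)

  ι : ∀ n → Cube B n → Cube⁺ n
  ι zero x = x
  ι (suc zero) x = x
  ι (suc (suc n)) x = inj₁ x

  ι-injective : ∀ n {x y} → ι n x ≡ ι n y → x ≡ y
  ι-injective zero p = p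
  ι-injective (suc zero) p = p
  ι-injective (suc (suc n)) refl = refl

  d⁺ : ∀ {n} → Fin (suc n) → Bool → Cube⁺ (suc n) → Cube⁺ n
  d⁺ {zero} i k x = d B i k x
  d⁺ {suc n} i k (inj₁ x) = ι (suc n) (d B i k x)
  d⁺ {suc n} i k (inj₂ refl) = ι (suc m) (b i k)

  d⁺-ι : ∀ n i k x → d⁺ {n} i k (ι (suc n) x) ≡ ι n (d B i k x)
  d⁺-ι zero i k x = refl
  d⁺-ι (suc n) i k x = refl

  cubical⁺ : IsShell B m b → ∀ {n} (i j : Fin (suc n)) (k l : Bool) (x : Cube⁺ (suc (suc n))) →
             toℕ i ≤ toℕ j → d⁺ i k (d⁺ (suc j) l x) ≡ d⁺ j l (d⁺ (inject₁ i) k x)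
  cubical⁺ shell {n} i j k l (inj₁ x) le = begin
    d⁺ i k (ι (suc n) (d B (suc j) l x))     ≡⟨ d⁺-ι n i k _ ⟩
    ι n (d B i k (d B (suc j) l x))          ≡⟨ cong (ι n) (cubical B i j k l x le) ⟩
    ι n (d B j l (d B (inject₁ i) k x))      ≡⟨ d⁺-ι n j l _ ⟨
    d⁺ j l (ι (suc n) (d B (inject₁ i) k x)) ∎
    where open ≡-Reasoning
  cubical⁺ shell {n} i j k l (inj₂ refl) le = begin
    d⁺ i k (ι (suc m) (b (suc j) l))     ≡⟨ d⁺-ι m i k _ ⟩
    ι m (d B i k (b (suc j) l))          ≡⟨ cong (ι m) (shell i j k l le) ⟩
    ι m (d B j l (b (inject₁ i) k))      ≡⟨ d⁺-ι m j l _ ⟨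
    d⁺ j l (ι (suc m) (b (inject₁ i) k)) ∎
    where open ≡-Reasoning

-- Stated for variable m, outside AdjoinFiller, so that m can be matched against 0.
module _ {T : ⋉TS} {B : HDA} (hB : HM1 B T) where
  open AdjoinedCubes

  adjoined-lab-face : ∀ m b → AdmissibleShell B T hB m b → (x : Cube⁺ B m b 2) (i : Fin 2) →
    lab B (d⁺ B m b {1} i false x) ≡ lab B (d⁺ B m b {1} i true x)
  adjoined-lab-face m b _ (inj₁ x) i = lab-face B x i
  adjoined-lab-face zero b (labels , _) (inj₂ refl) i = labels i

  adjoined-HM2 : HM2 B T hB → ∀ m b → AdmissibleShell B T hB m b → (x : Cube⁺ B m b 2) →
    ⋉ T (coe (eL hB) (lab B (d⁺ B m b {1} (suc zero) false x)))
        (coe (eL hB) (lab B (d⁺ B m b {1} zero false x)))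
  adjoined-HM2 hm2B m b _ (inj₁ x) = hm2B x
  adjoined-HM2 hm2B zero b (_ , related) (inj₂ refl) = related

module AdjoinFiller {T : ⋉TS} {B : HDA} (hB : HM1 B T) (m : ℕ) (b : Shell B m)
                    (shell : IsShell B m b) (admissible : AdmissibleShell B T hB m b) where
  open AdjoinedCubes B m b

  B⁺ : HDA
  B⁺ = record
    { P = record { Cube = Cube⁺ ; d = d⁺ ; cubical = cubical⁺ shell }
    ; I = I B ; F = F B ; Lab = Lab B ; lab = lab B
    ; lab-face = adjoined-lab-face hB m b admissible }

  B⁺-HM1 : HM1 B⁺ T
  B⁺-HM1 = record { e0 = e0 hB ; e1 = e1 hB ; eL = eL hB ; d-eq = d-eq hB
                  ; I-eq = I-eq hB ; F-eq = F-eq hB ; lab-eq = lab-eq hB }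

  B⁺-HM2 : HM2 B T hB → HM2 B⁺ T B⁺-HM1
  B⁺-HM2 hm2B = adjoined-HM2 hB hm2B m b admissible

  B⁺-HM3 : HM3 B → ¬ Filler B m b → HM3 B⁺
  B⁺-HM3 hm3B _ n (inj₁ x) (inj₁ y) faces =
    cong inj₁ (hm3B n x y λ r k → ι-injective (suc n) (faces r k))
  B⁺-HM3 hm3B _ n (inj₂ refl) (inj₂ e) faces = cong inj₂ (≡-irrelevant refl e)
  B⁺-HM3 hm3B unfillable n (inj₁ x) (inj₂ refl) faces =
    ⊥-elim (unfillable (x , λ r k → ι-injective (suc m) (faces r k)))
  B⁺-HM3 hm3B unfillable n (inj₂ refl) (inj₁ y) faces =
    ⊥-elim (unfillable (y , λ r k → ι-injective (suc m) (sym (faces r k))))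

  inclusion : SubEmbedding B B⁺
  inclusion = record
    { emb = record { g = ι ; g-d = λ {n} i k x → sym (d⁺-ι n i k x) ; σ = λ a → a
                   ; g-I = refl ; g-F = λ _ fv → fv ; g-lab = λ _ → refl }
    ; g-inj = ι-injective
    ; σ-inj = λ p → p }

  inclusion-idOnSkeleton : IdOnSkeleton hB B⁺-HM1 inclusion
  inclusion-idOnSkeleton = (λ _ → refl) , (λ _ → refl) , (λ _ → refl)

  inclusion-proper : IsProper inclusion
  inclusion-proper (onto , _) with onto (suc (suc m)) (inj₂ refl)
  ... | _ , ()

model-fills-admissible-shells : ExcludedMiddle 0ℓ → {T : ⋉TS} {B : HDA} (mB : HDAModel B T) →
  ∀ m (b : Shell B m) → IsShell B m b → AdmissibleShell B T (hm1 mB) m b → Filler B m b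
model-fills-admissible-shells lem {B = B} mB m b shell admissible with lem {Filler B m b}
... | yes filler = filler
... | no unfillable = ⊥-elim (hm4 mB B⁺ B⁺-HM1 (B⁺-HM2 (hm2 mB))
        (B⁺-HM3 (hm3 mB) unfillable) inclusion
        inclusion-idOnSkeleton inclusion-proper)
  where open AdjoinFiller (hm1 mB) m b shell admissible

record Hom≤1 (A B : HDA) : Set where
  field
    g₀ : Cube A 0 → Cube B 0
    g₁ : Cube A 1 → Cube B 1
    g₀-d : ∀ i k x → g₀ (d A i k x) ≡ d B i k (g₁ x)
    σ₁ : Lab A → Lab B
    g₀-I : g₀ (I A) ≡ I B
    g₀-F : ∀ v → F A v → F B (g₀ v)
    g₁-lab : ∀ x → lab B (g₁ x) ≡ σ₁ (lab A x)

open Hom≤1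

lab-face-image : {A B : HDA} (h≤1 : Hom≤1 A B) (x : Cube A 2) (i : Fin 2) →
  lab B (g₁ h≤1 (d A i false x)) ≡ lab B (g₁ h≤1 (d A i true x))
lab-face-image {A} {B} h≤1 x i = begin
  lab B (g₁ h≤1 (d A i false x)) ≡⟨ g₁-lab h≤1 _ ⟩
  σ₁ h≤1 (lab A (d A i false x)) ≡⟨ cong (σ₁ h≤1) (lab-face A x i) ⟩
  σ₁ h≤1 (lab A (d A i true x))  ≡⟨ g₁-lab h≤1 _ ⟨
  lab B (g₁ h≤1 (d A i true x))  ∎
  where open ≡-Reasoning

record Extends {A B : HDA} (h : HDAHom A B) (h≤1 : Hom≤1 A B) : Set where
  constructor extends
  field
    extends₀ : ∀ x → g h 0 x ≡ g₀ h≤1 x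
    extends₁ : ∀ x → g h 1 x ≡ g₁ h≤1 x
    extendsσ : ∀ a → σ h a ≡ σ₁ h≤1 a

record Layer (A B : HDA) (n : ℕ) : Set where
  field
    lower : Cube A n → Cube B n
    upper : Cube A (suc n) → Cube B (suc n)
    lower-d : ∀ i k x → lower (d A i k x) ≡ d B i k (upper x)

open Layer

imageShell : {A B : HDA} {n : ℕ} → Layer A B n → Cube A (suc (suc n)) → Shell B n
imageShell {A} L x r k = upper L (d A r k x)

imageShell-isShell : {A B : HDA} {n : ℕ} (L : Layer A B n) (x : Cube A (suc (suc n))) →
  IsShell B n (imageShell L x)
imageShell-isShell {A} {B} L x i j k l le = begin
  d B i k (upper L (d A (suc j) l x))     ≡⟨ lower-d L i k _ ⟨
  lower L (d A i k (d A (suc j) l x))     ≡⟨ cong (lower L) (cubical A i j k l x le) ⟩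
  lower L (d A j l (d A (inject₁ i) k x)) ≡⟨ lower-d L j l _ ⟩
  d B j l (upper L (d A (inject₁ i) k x)) ∎
  where open ≡-Reasoning

nextLayer : {A B : HDA} {n : ℕ} (L : Layer A B n) →
  (∀ x → Filler B n (imageShell L x)) → Layer A B (suc n)
nextLayer L fill = record
  { lower = upper L
  ; upper = λ x → proj₁ (fill x)
  ; lower-d = λ i k x → sym (proj₂ (fill x) i k) }

module Extension {A B : HDA} (h≤1 : Hom≤1 A B) where

  baseLayer : Layer A B 0
  baseLayer = record { lower = g₀ h≤1 ; upper = g₁ h≤1 ; lower-d = g₀-d h≤1 }

  module _ (fill₂ : ∀ x → Filler B 0 (imageShell baseLayer x))
           (fill : ∀ m (b : Shell B (suc m)) → IsShell B (suc m) b → Filler B (suc m) b) where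

    layer : ∀ n → Layer A B n
    layer zero = baseLayer
    layer (suc zero) = nextLayer baseLayer fill₂
    layer (suc (suc n)) =
      nextLayer (layer (suc n)) λ x → fill n _ (imageShell-isShell (layer (suc n)) x)

    layer-d : ∀ n i k x → lower (layer n) (d A i k x) ≡ d B i k (lower (layer (suc n)) x)
    layer-d zero = lower-d baseLayer
    layer-d (suc n) = lower-d (layer (suc n))

    extension : HDAHom A B
    extension = record
      { g = λ n → lower (layer n)
      ; g-d = λ {n} → layer-d n
      ; σ = σ₁ h≤1
      ; g-I = g₀-I h≤1
      ; g-F = g₀-F h≤1
      ; g-lab = g₁-lab h≤1 }

    extension-extends : Extends extension h≤1
    extension-extends = extends (λ _ → refl) (λ _ → refl) (λ _ → refl)

HM3⇒agree-from-degree-1 : {A B : HDA} → HM3 B → (h h' : HDAHom A B) →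
  (∀ x → g h 1 x ≡ g h' 1 x) → ∀ n x → g h (suc n) x ≡ g h' (suc n) x
HM3⇒agree-from-degree-1 hm3B h h' agree₁ zero x = agree₁ x
HM3⇒agree-from-degree-1 {A} {B} hm3B h h' agree₁ (suc n) x = hm3B n _ _ λ r k → begin
  d B r k (g h (suc (suc n)) x)  ≡⟨ g-d h r k x ⟨
  g h (suc n) (d A r k x)        ≡⟨ HM3⇒agree-from-degree-1 hm3B h h' agree₁ n _ ⟩
  g h' (suc n) (d A r k x)       ≡⟨ g-d h' r k x ⟩
  d B r k (g h' (suc (suc n)) x) ∎
  where open ≡-Reasoning

extends-unique : {A B : HDA} {h≤1 : Hom≤1 A B} (h h' : HDAHom A B) → HM3 B →
  Extends h h≤1 → Extends h' h≤1 → HomEq h h'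
extends-unique h h' hm3B (extends e₀ e₁ eσ) (extends e₀' e₁' eσ') =
  agree , λ a → trans (eσ a) (sym (eσ' a))
  where
  agree : ∀ n x → g h n x ≡ g h' n x
  agree zero x = trans (e₀ x) (sym (e₀' x))
  agree (suc n) = HM3⇒agree-from-degree-1 hm3B h h' (λ x → trans (e₁ x) (sym (e₁' x))) n

module Transport {S T : ⋉TS} {A B : HDA} (hA : HM1 A S) (hB : HM1 B T) (f : ⋉Hom S T) where

  open ≡-Reasoning

  transported-g₁ : Cube A 1 → Cube B 1
  transported-g₁ x = coe⁻ (e1 hB) (g (hom f) 1 (coe (e1 hA) x))

  transported-lab : ∀ x →
    coe (eL hB) (lab B (transported-g₁ x)) ≡ σ (hom f) (coe (eL hA) (lab A x))
  transported-lab x = begin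
    coe (eL hB) (lab B (transported-g₁ x))     ≡⟨ lab-eq hB (transported-g₁ x) ⟩
    lab (U T) (coe (e1 hB) (transported-g₁ x)) ≡⟨ cong (lab (U T)) (coe-coe⁻ (e1 hB) _) ⟩
    lab (U T) (g (hom f) 1 (coe (e1 hA) x))    ≡⟨ g-lab (hom f) _ ⟩
    σ (hom f) (lab (U S) (coe (e1 hA) x))      ≡⟨ cong (σ (hom f)) (lab-eq hA x) ⟨
    σ (hom f) (coe (eL hA) (lab A x))          ∎

  transported-g₀-d : ∀ i k x →
    coe⁻ (e0 hB) (g (hom f) 0 (coe (e0 hA) (d A i k x))) ≡ d B i k (transported-g₁ x)
  transported-g₀-d i k x = coe⁻-transpose (e0 hB) (begin
    g (hom f) 0 (coe (e0 hA) (d A i k x))       ≡⟨ cong (g (hom f) 0) (d-eq hA i k x) ⟩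
    g (hom f) 0 (d (U S) i k (coe (e1 hA) x))   ≡⟨ g-d (hom f) i k _ ⟩
    d (U T) i k (g (hom f) 1 (coe (e1 hA) x))   ≡⟨ cong (d (U T) i k) (coe-coe⁻ (e1 hB) _) ⟨
    d (U T) i k (coe (e1 hB) (transported-g₁ x)) ≡⟨ d-eq hB i k (transported-g₁ x) ⟨
    coe (e0 hB) (d B i k (transported-g₁ x))     ∎)

  transported : Hom≤1 A B
  transported = record
    { g₀ = λ x → coe⁻ (e0 hB) (g (hom f) 0 (coe (e0 hA) x))
    ; g₁ = transported-g₁
    ; g₀-d = transported-g₀-d
    ; σ₁ = λ a → coe⁻ (eL hB) (σ (hom f) (coe (eL hA) a))
    ; g₀-I = coe⁻-transpose (e0 hB) (begin
        g (hom f) 0 (coe (e0 hA) (I A)) ≡⟨ cong (g (hom f) 0) (I-eq hA) ⟩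
        g (hom f) 0 (I (U S))           ≡⟨ g-I (hom f) ⟩
        I (U T)                         ≡⟨ I-eq hB ⟨
        coe (e0 hB) (I B)               ∎)
    ; g₀-F = λ v fv → proj₂ (F-eq hB _)
        (subst (F (U T)) (sym (coe-coe⁻ (e0 hB) _)) (g-F (hom f) _ (proj₁ (F-eq hA v) fv)))
    ; g₁-lab = λ x → coe-transpose (eL hB) (transported-lab x) }

  transported-admissible : HM2 A S hA → ∀ x →
    AdmissibleShell B T hB 0 (imageShell (Extension.baseLayer transported) x)
  transported-admissible hA2 x =
      lab-face-image transported x
    , subst₂ (⋉ T) (sym (transported-lab _)) (sym (transported-lab _)) (pres f _ _ (hA2 x))

  extends⇒restrictsTo : (h : HDAHom A B) → Extends h transported → RestrictsTo hA hB h f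
  extends⇒restrictsTo h (extends e₀ e₁ eσ) =
      (λ x → trans (cong (coe (e0 hB)) (e₀ x)) (coe-coe⁻ (e0 hB) _))
    , (λ x → trans (cong (coe (e1 hB)) (e₁ x)) (coe-coe⁻ (e1 hB) _))
    , (λ a → trans (cong (coe (eL hB)) (eσ a)) (coe-coe⁻ (eL hB) _))

  restrictsTo⇒extends : (h : HDAHom A B) → RestrictsTo hA hB h f → Extends h transported
  restrictsTo⇒extends h (r₀ , r₁ , rσ) =
    extends (λ x → coe-transpose (e0 hB) (r₀ x)) (λ x → coe-transpose (e1 hB) (r₁ x))
            (λ a → coe-transpose (eL hB) (rσ a))

proposition4p4 : ExcludedMiddle 0ℓ →
    (S T : ⋉TS) (A : HDA) (hA1 : HM1 A S) (hA2 : HM2 A S hA1)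
    (B : HDA) (mB : HDAModel B T) (f : ⋉Hom S T) →
    Σ (HDAHom A B) λ h →
      RestrictsTo hA1 (HDAModel.hm1 mB) h f ×
      (∀ (h' : HDAHom A B) → RestrictsTo hA1 (HDAModel.hm1 mB) h' f → HomEq h h')
proposition4p4 lem S T A hA1 hA2 B mB f =
    h
  , extends⇒restrictsTo h h-extends
  , λ h' r → extends-unique h h' (hm3 mB) h-extends (restrictsTo⇒extends h' r)
  where
  open Transport hA1 (hm1 mB) f
  open Extension transported

  fill₂ : ∀ x → Filler B 0 (imageShell baseLayer x)
  fill₂ x = model-fills-admissible-shells lem mB 0 _
              (imageShell-isShell baseLayer x) (transported-admissible hA2 x)

  fill≥3 : ∀ m (b : Shell B (suc m)) → IsShell B (suc m) b → Filler B (suc m) b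
  fill≥3 m b shell = model-fills-admissible-shells lem mB (suc m) b shell tt

  h : HDAHom A B
  h = extension fill₂ fill≥3

  h-extends : Extends h transported
  h-extends = extension-extends fill₂ fill≥3
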